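{- Let $P$ be a program and $p,p'$ positions of $P$. Then $p\leq p'$ if and only if $p\to^* p'$, i.e. there is a finite (possibly empty) sequence of reductions $P\vdash p=p_0\to p_1\to\cdots\to p_k=p'$.
   Context: Fix a set $\mathcal A$ of actions. Programs are generated by $P,Q::=A\mid P;Q\mid P^{*}\mid P+Q\mid P\parallel Q$ with $A\in\mathcal A$. Pre-positions are generated by $p,q::=\bot\mid\top\mid p;q\mid p^{(n)}\mid p+q\mid p\parallel q$ with $n\in\mathbb N$. Validity $P\vdash p$ ("$p$ is a position of $P$") is defined inductively: $P\vdash\bot$ and $P\vdash\top$ for all $P$; if $P\vdash p$ then $P;Q\vdash p;\bot$, $P+Q\vdash p+\bot$, and $P^*\vdash p^{(n)}$ for all $n$; if $Q\vdash q$ then $P;Q\vdash\top;q$ and $P+Q\vdash\bot+q$; if $P\vdash p$ and $Q\vdash q$ then $P\parallel Q\vdash p\parallel q$. The reduction relation $P\vdash p\to p'$ is defined inductively by: $A\vdash\bot\to\top$; $P;Q\vdash\bot\to\bot;\bot$; $P+Q\vdash\bot\to\bot+\bot$; $P^*\vdash\bot\to\bot^{(0)}$; $P\parallel Q\vdash\bot\to\bot\parallel\bot$; if $P\vdash p\to p'$ then $P;Q\vdash p;\bot\to p';\bot$, $P+Q\vdash p+\bot\to p'+\bot$, $P^*\vdash p^{(n)}\to p'^{(n)}$, and $P\parallel Q\vdash p\parallel q\to p'\parallel q$ for every $q$ with $Q\vdash q$; if $Q\vdash q\to q'$ then $P;Q\vdash\top;q\to\top;q'$, $P+Q\vdash\bot+q\to\bot+q'$,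 and $P\parallel Q\vdash p\parallel q\to p\parallel q'$ for every $p$ with $P\vdash p$; $P^*\vdash\top^{(n)}\to\bot^{(n+1)}$; $P;Q\vdash\top;\top\to\top$; $P+Q\vdash\top+\bot\to\top$; $P+Q\vdash\bot+\top\to\top$; $P^*\vdash\top^{(n)}\to\top$; $P\parallel Q\vdash\top\parallel\top\to\top$; $P^*\vdash\bot\to\top$ (for all $n\in\mathbb N$). The order $\leq$ on positions of $P$ is the smallest reflexive relation such that: $\bot\leq p$; $p\leq\top$; if $p\leq p'$ and $q\leq q'$ then $p;q\leq p';q'$, $p+q\leq p'+q'$ and $p\parallel q\leq p'\parallel q'$; if $p\leq p'$ then $p^{(n)}\leq p'^{(n)}$; and $p^{(m)}\leq p'^{(n)}$ whenever $m<n$ (all these being positions of the relevant programs). -}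

module Defs where

open import Data.Nat using (ℕ; suc; _<_)

data Prog (A : Set) : Set where
  act  : A → Prog A
  seq  : Prog A → Prog A → Prog A
  star : Prog A → Prog A
  plus : Prog A → Prog A → Prog A
  par  : Prog A → Prog A → Prog A

data PrePos : Set where
  bot   : PrePos
  top   : PrePos
  pseq  : PrePos → PrePos → PrePos
  pit   : PrePos → ℕ → PrePos
  pplus : PrePos → PrePos → PrePos
  ppar  : PrePos → PrePos → PrePos

data Valid {A : Set} : Prog A → PrePos → Set where
  v-bot   : ∀ {P} → Valid P bot
  v-top   : ∀ {P} → Valid P top
  v-seqL  : ∀ {P Q p} → Valid P p → Valid (seq P Q) (pseq p bot)
  v-plusL : ∀ {P Q p} → Valid P p → Valid (plus P Q) (pplus p bot)
  v-star  : ∀ {P p} (n : ℕ) → Valid P p → Valid (star P) (pit p n)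
  v-seqR  : ∀ {P Q q} → Valid Q q → Valid (seq P Q) (pseq top q)
  v-plusR : ∀ {P Q q} → Valid Q q → Valid (plus P Q) (pplus bot q)
  v-par   : ∀ {P Q p q} → Valid P p → Valid Q q → Valid (par P Q) (ppar p q)

data Step {A : Set} : Prog A → PrePos → PrePos → Set where
  s-act      : ∀ {a} → Step (act a) bot top
  s-seq-init : ∀ {P Q} → Step (seq P Q) bot (pseq bot bot)
  s-plus-init : ∀ {P Q} → Step (plus P Q) bot (pplus bot bot)
  s-star-init : ∀ {P} → Step (star P) bot (pit bot 0)
  s-par-init : ∀ {P Q} → Step (par P Q) bot (ppar bot bot)
  s-seqL     : ∀ {P Q p p'} → Step P p p' → Step (seq P Q) (pseq p bot) (pseq p' bot)
  s-plusL    : ∀ {P Q p p'} → Step P p p' → Step (plus P Q) (pplus p bot) (pplus p' bot)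
  s-star     : ∀ {P p p'} (n : ℕ) → Step P p p' → Step (star P) (pit p n) (pit p' n)
  s-parL     : ∀ {P Q p p' q} → Step P p p' → Valid Q q → Step (par P Q) (ppar p q) (ppar p' q)
  s-seqR     : ∀ {P Q q q'} → Step Q q q' → Step (seq P Q) (pseq top q) (pseq top q')
  s-plusR    : ∀ {P Q q q'} → Step Q q q' → Step (plus P Q) (pplus bot q) (pplus bot q')
  s-parR     : ∀ {P Q p q q'} → Step Q q q' → Valid P p → Step (par P Q) (ppar p q) (ppar p q')
  s-star-loop : ∀ {P} (n : ℕ) → Step (star P) (pit top n) (pit bot (suc n))
  s-seq-fin  : ∀ {P Q} → Step (seq P Q) (pseq top top) top
  s-plusL-fin : ∀ {P Q} → Step (plus P Q) (pplus top bot) top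
  s-plusR-fin : ∀ {P Q} → Step (plus P Q) (pplus bot top) top
  s-star-fin : ∀ {P} (n : ℕ) → Step (star P) (pit top n) top
  s-par-fin  : ∀ {P Q} → Step (par P Q) (ppar top top) top
  s-star-skip : ∀ {P} → Step (star P) bot top

-- The order ≤ on positions of P (every related pre-position is a position
-- of the relevant program)
data Le {A : Set} : Prog A → PrePos → PrePos → Set where
  le-refl : ∀ {P p} → Valid P p → Le P p p
  le-bot  : ∀ {P p} → Valid P p → Le P bot p
  le-top  : ∀ {P p} → Valid P p → Le P p top
  le-seq  : ∀ {P Q p p' q q'} → Le P p p' → Le Q q q' →
            Valid (seq P Q) (pseq p q) → Valid (seq P Q) (pseq p' q') →
            Le (seq P Q) (pseq p q) (pseq p' q')
  le-plus : ∀ {P Q p p' q q'} → Le P p p' → Le Q q q' →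
            Valid (plus P Q) (pplus p q) → Valid (plus P Q) (pplus p' q') →
            Le (plus P Q) (pplus p q) (pplus p' q')
  le-par  : ∀ {P Q p p' q q'} → Le P p p' → Le Q q q' →
            Le (par P Q) (ppar p q) (ppar p' q')
  le-star : ∀ {P p p'} (n : ℕ) → Le P p p' → Le (star P) (pit p n) (pit p' n)
  le-iter : ∀ {P p p'} {m n : ℕ} → m < n → Valid P p → Valid P p' →
            Le (star P) (pit p m) (pit p' n)

-- ⊥ reduces to every position and every position reduces to ⊤, by induction on
-- validity; an iteration p^(n) is reached from ⊥ by running the body n times
-- through ⊤^(k) → ⊥^(k+1). Since reductions lift through the congruence rules,
-- every generating clause of ≤ is realised by a reduction sequence. Conversely
-- every single reduction is an instance of ≤, and ≤ is transitive.
module Submission where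

open import Defs
open import Function.Bundles using (_⇔_; mk⇔)
open import Relation.Binary.Construct.Closure.ReflexiveTransitive
  using (Star; ε; _◅_; _◅◅_; gmap)
open import Data.Nat using (suc; _≤′_; ≤′-reflexive; ≤′-step)
open import Data.Nat.Properties using (<-trans; n<1+n; ≤⇒≤′; z≤′n)
open import Data.Product using (_×_; _,_; proj₁; proj₂)
open import Relation.Binary.PropositionalEquality using (_≡_; refl)

module _ {A : Set} where

  Steps : Prog A → PrePos → PrePos → Set
  Steps P = Star (Step P)

  Steps-seqL : ∀ {P Q p p'} → Steps P p p' → Steps (seq P Q) (pseq p bot) (pseq p' bot)
  Steps-seqL = gmap (λ p → pseq p bot) s-seqL

  Steps-seqR : ∀ {P Q q q'} → Steps Q q q' → Steps (seq P Q) (pseq top q) (pseq top q')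
  Steps-seqR = gmap (pseq top) s-seqR

  Steps-plusL : ∀ {P Q p p'} → Steps P p p' → Steps (plus P Q) (pplus p bot) (pplus p' bot)
  Steps-plusL = gmap (λ p → pplus p bot) s-plusL

  Steps-plusR : ∀ {P Q q q'} → Steps Q q q' → Steps (plus P Q) (pplus bot q) (pplus bot q')
  Steps-plusR = gmap (pplus bot) s-plusR

  Steps-star : ∀ {P p p'} n → Steps P p p' → Steps (star P) (pit p n) (pit p' n)
  Steps-star n = gmap (λ p → pit p n) (s-star n)

  Steps-parL : ∀ {P Q p p' q} → Valid Q q → Steps P p p' → Steps (par P Q) (ppar p q) (ppar p' q)
  Steps-parL {q = q} vq = gmap (λ p → ppar p q) (λ s → s-parL s vq)

  Steps-parR : ∀ {P Q p q q'} → Valid P p → Steps Q q q' → Steps (par P Q) (ppar p q) (ppar p q')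
  Steps-parR {p = p} vp = gmap (ppar p) (λ s → s-parR s vp)

  bot↠top : (P : Prog A) → Steps P bot top
  bot↠top (act a)    = s-act ◅ ε
  bot↠top (seq P Q)  = s-seq-init ◅ Steps-seqL (bot↠top P) ◅◅ Steps-seqR (bot↠top Q) ◅◅ s-seq-fin ◅ ε
  bot↠top (star P)   = s-star-skip ◅ ε
  bot↠top (plus P Q) = s-plus-init ◅ Steps-plusL (bot↠top P) ◅◅ s-plusL-fin ◅ ε
  bot↠top (par P Q)  =
    s-par-init ◅ Steps-parL v-bot (bot↠top P) ◅◅ Steps-parR v-top (bot↠top Q) ◅◅ s-par-fin ◅ ε

  bot-iter↠bot-iter : ∀ {P m n} → m ≤′ n → Steps (star P) (pit bot m) (pit bot n)
  bot-iter↠bot-iter (≤′-reflexive refl) = ε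
  bot-iter↠bot-iter {P} (≤′-step {n} m≤n) =
    bot-iter↠bot-iter m≤n ◅◅ Steps-star n (bot↠top P) ◅◅ s-star-loop n ◅ ε

  bot↠ : ∀ {P : Prog A} {p} → Valid P p → Steps P bot p
  bot↠ v-bot          = ε
  bot↠ {P} v-top      = bot↠top P
  bot↠ (v-seqL vp)    = s-seq-init ◅ Steps-seqL (bot↠ vp)
  bot↠ (v-seqR {P} vq) = s-seq-init ◅ Steps-seqL (bot↠top P) ◅◅ Steps-seqR (bot↠ vq)
  bot↠ (v-plusL vp)   = s-plus-init ◅ Steps-plusL (bot↠ vp)
  bot↠ (v-plusR vq)   = s-plus-init ◅ Steps-plusR (bot↠ vq)
  bot↠ (v-star n vp)  =
    s-star-init ◅ bot-iter↠bot-iter z≤′n ◅◅ Steps-star n (bot↠ vp)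
  bot↠ (v-par vp vq)  = s-par-init ◅ Steps-parL v-bot (bot↠ vp) ◅◅ Steps-parR vp (bot↠ vq)

  ↠top : ∀ {P : Prog A} {p} → Valid P p → Steps P p top
  ↠top {P} v-bot       = bot↠top P
  ↠top v-top           = ε
  ↠top (v-seqL {Q = Q} vp) = Steps-seqL (↠top vp) ◅◅ Steps-seqR (bot↠top Q) ◅◅ s-seq-fin ◅ ε
  ↠top (v-seqR vq)     = Steps-seqR (↠top vq) ◅◅ s-seq-fin ◅ ε
  ↠top (v-plusL vp)    = Steps-plusL (↠top vp) ◅◅ s-plusL-fin ◅ ε
  ↠top (v-plusR vq)    = Steps-plusR (↠top vq) ◅◅ s-plusR-fin ◅ ε
  ↠top (v-star n vp)   = Steps-star n (↠top vp) ◅◅ s-star-fin n ◅ ε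
  ↠top (v-par vp vq)   = Steps-parL vq (↠top vp) ◅◅ Steps-parR v-top (↠top vq) ◅◅ s-par-fin ◅ ε

  Le-valid : ∀ {P : Prog A} {p q} → Le P p q → Valid P p × Valid P q
  Le-valid (le-refl v)               = v , v
  Le-valid (le-bot v)                = v-bot , v
  Le-valid (le-top v)                = v , v-top
  Le-valid (le-seq _ _ v w)          = v , w
  Le-valid (le-plus _ _ v w)         = v , w
  Le-valid (le-par a b)              =
    v-par (proj₁ (Le-valid a)) (proj₁ (Le-valid b)) , v-par (proj₂ (Le-valid a)) (proj₂ (Le-valid b))
  Le-valid (le-star n a)             = v-star n (proj₁ (Le-valid a)) , v-star n (proj₂ (Le-valid a))
  Le-valid (le-iter {m = m} {n} _ v w) = v-star m v , v-star n w

  top-Le⇒≡top : ∀ {P : Prog A} {q} → Le P top q → q ≡ top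
  top-Le⇒≡top (le-refl _) = refl
  top-Le⇒≡top (le-top _)  = refl

  Le-bot⇒≡bot : ∀ {P : Prog A} {p} → Le P p bot → p ≡ bot
  Le-bot⇒≡bot (le-refl _) = refl
  Le-bot⇒≡bot (le-bot _)  = refl

  Le⇒Steps : ∀ {P : Prog A} {p q} → Le P p q → Steps P p q
  Le⇒Steps (le-refl _) = ε
  Le⇒Steps (le-bot v)  = bot↠ v
  Le⇒Steps (le-top v)  = ↠top v
  Le⇒Steps (le-seq a _ (v-seqL _) (v-seqL _))   = Steps-seqL (Le⇒Steps a)
  Le⇒Steps (le-seq _ _ (v-seqL vp) (v-seqR vq)) = Steps-seqL (↠top vp) ◅◅ Steps-seqR (bot↠ vq)
  Le⇒Steps (le-seq a b (v-seqR _) (v-seqL _)) with top-Le⇒≡top a | Le-bot⇒≡bot b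
  ... | refl | refl = ε
  Le⇒Steps (le-seq _ b (v-seqR _) (v-seqR _))   = Steps-seqR (Le⇒Steps b)
  Le⇒Steps (le-plus a _ (v-plusL _) (v-plusL _)) = Steps-plusL (Le⇒Steps a)
  Le⇒Steps (le-plus a b (v-plusL _) (v-plusR _)) with Le-bot⇒≡bot a
  ... | refl = Steps-plusR (Le⇒Steps b)
  Le⇒Steps (le-plus a b (v-plusR _) (v-plusL _)) with Le-bot⇒≡bot b
  ... | refl = Steps-plusL (Le⇒Steps a)
  Le⇒Steps (le-plus _ b (v-plusR _) (v-plusR _)) = Steps-plusR (Le⇒Steps b)
  Le⇒Steps (le-par a b) =
    Steps-parL (proj₁ (Le-valid b)) (Le⇒Steps a) ◅◅ Steps-parR (proj₂ (Le-valid a)) (Le⇒Steps b)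
  Le⇒Steps (le-star n a) = Steps-star n (Le⇒Steps a)
  Le⇒Steps (le-iter {m = m} m<n vp vp') =
    Steps-star m (↠top vp) ◅◅ s-star-loop m ◅ bot-iter↠bot-iter (≤⇒≤′ m<n) ◅◅ Steps-star _ (bot↠ vp')

  Step-valid : ∀ {P : Prog A} {p q} → Step P p q → Valid P p × Valid P q
  Step-valid s-act          = v-bot , v-top
  Step-valid s-seq-init     = v-bot , v-seqL v-bot
  Step-valid s-plus-init    = v-bot , v-plusL v-bot
  Step-valid s-star-init    = v-bot , v-star 0 v-bot
  Step-valid s-par-init     = v-bot , v-par v-bot v-bot
  Step-valid (s-seqL s)     = v-seqL (proj₁ (Step-valid s)) , v-seqL (proj₂ (Step-valid s))
  Step-valid (s-plusL s)    = v-plusL (proj₁ (Step-valid s)) , v-plusL (proj₂ (Step-valid s))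
  Step-valid (s-star n s)   = v-star n (proj₁ (Step-valid s)) , v-star n (proj₂ (Step-valid s))
  Step-valid (s-parL s vq)  = v-par (proj₁ (Step-valid s)) vq , v-par (proj₂ (Step-valid s)) vq
  Step-valid (s-seqR s)     = v-seqR (proj₁ (Step-valid s)) , v-seqR (proj₂ (Step-valid s))
  Step-valid (s-plusR s)    = v-plusR (proj₁ (Step-valid s)) , v-plusR (proj₂ (Step-valid s))
  Step-valid (s-parR s vp)  = v-par vp (proj₁ (Step-valid s)) , v-par vp (proj₂ (Step-valid s))
  Step-valid (s-star-loop n) = v-star n v-top , v-star (suc n) v-bot
  Step-valid s-seq-fin      = v-seqR v-top , v-top
  Step-valid s-plusL-fin    = v-plusL v-top , v-top
  Step-valid s-plusR-fin    = v-plusR v-top , v-top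
  Step-valid (s-star-fin n) = v-star n v-top , v-top
  Step-valid s-par-fin      = v-par v-top v-top , v-top
  Step-valid s-star-skip    = v-bot , v-top

  Step⇒Le : ∀ {P : Prog A} {p q} → Step P p q → Le P p q
  Step⇒Le s-act           = le-bot v-top
  Step⇒Le s-seq-init      = le-bot (v-seqL v-bot)
  Step⇒Le s-plus-init     = le-bot (v-plusL v-bot)
  Step⇒Le s-star-init     = le-bot (v-star 0 v-bot)
  Step⇒Le s-par-init      = le-bot (v-par v-bot v-bot)
  Step⇒Le (s-seqL s) =
    le-seq (Step⇒Le s) (le-refl v-bot) (v-seqL (proj₁ (Step-valid s))) (v-seqL (proj₂ (Step-valid s)))
  Step⇒Le (s-plusL s) =
    le-plus (Step⇒Le s) (le-refl v-bot) (v-plusL (proj₁ (Step-valid s))) (v-plusL (proj₂ (Step-valid s)))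
  Step⇒Le (s-star n s)    = le-star n (Step⇒Le s)
  Step⇒Le (s-parL s vq)   = le-par (Step⇒Le s) (le-refl vq)
  Step⇒Le (s-seqR s) =
    le-seq (le-refl v-top) (Step⇒Le s) (v-seqR (proj₁ (Step-valid s))) (v-seqR (proj₂ (Step-valid s)))
  Step⇒Le (s-plusR s) =
    le-plus (le-refl v-bot) (Step⇒Le s) (v-plusR (proj₁ (Step-valid s))) (v-plusR (proj₂ (Step-valid s)))
  Step⇒Le (s-parR s vp)   = le-par (le-refl vp) (Step⇒Le s)
  Step⇒Le (s-star-loop n) = le-iter (n<1+n n) v-top v-bot
  Step⇒Le s-seq-fin       = le-top (v-seqR v-top)
  Step⇒Le s-plusL-fin     = le-top (v-plusL v-top)
  Step⇒Le s-plusR-fin     = le-top (v-plusR v-top)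
  Step⇒Le (s-star-fin n)  = le-top (v-star n v-top)
  Step⇒Le s-par-fin       = le-top (v-par v-top v-top)
  Step⇒Le s-star-skip     = le-bot v-top

  Le-trans : ∀ {P : Prog A} {p q r} → Le P p q → Le P q r → Le P p r
  Le-trans (le-refl _) y = y
  Le-trans x (le-refl _) = x
  Le-trans (le-bot _) y  = le-bot (proj₂ (Le-valid y))
  Le-trans x (le-top _)  = le-top (proj₁ (Le-valid x))
  Le-trans (le-seq a b v _) (le-seq c d _ w)   = le-seq (Le-trans a c) (Le-trans b d) v w
  Le-trans (le-plus a b v _) (le-plus c d _ w) = le-plus (Le-trans a c) (Le-trans b d) v w
  Le-trans (le-par a b) (le-par c d)           = le-par (Le-trans a c) (Le-trans b d)
  Le-trans (le-star n a) (le-star _ c)         = le-star n (Le-trans a c)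
  Le-trans (le-star _ a) (le-iter m<n _ w)     = le-iter m<n (proj₁ (Le-valid a)) w
  Le-trans (le-iter m<n v _) (le-star _ c)     = le-iter m<n v (proj₂ (Le-valid c))
  Le-trans (le-iter l v _) (le-iter l' _ w)    = le-iter (<-trans l l') v w

  Steps⇒Le : ∀ {P : Prog A} {p q} → Valid P p → Steps P p q → Le P p q
  Steps⇒Le vp ε       = le-refl vp
  Steps⇒Le _ (s ◅ ss) = Le-trans (Step⇒Le s) (Steps⇒Le (proj₂ (Step-valid s)) ss)

proposition2p8 : {A : Set} (P : Prog A) (p p' : PrePos) →
    Valid P p → Valid P p' →
    (Le P p p' ⇔ Star (Step P) p p')
proposition2p8 P p p' vp _ = mk⇔ Le⇒Steps (Steps⇒Le vp)
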